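{- Let $S=\langle K,\overline{K},\Gamma\cup\{\infty\},v,\mathrm{ac}\rangle$ be an $\mathcal{L}_{RRP}$-structure with $\mathrm{char}\,K=0$, $\mathrm{char}\,\overline{K}=0$, $v$ a valuation map, $\mathrm{ac}$ an angular component map, $\Gamma$ a $\mathbb{Z}$-group, and $\mathrm{Th}(S)$ admitting quantifier elimination in the $K$-sort. Let $\varphi$ be a simple formula in $\mathcal{L}_{RRP}$. Then $\varphi$ is equivalent to a formula of the form $\bigvee_i(\sigma_i\wedge\chi_i\wedge\theta_i)$, where each $\sigma_i$ is a quantifier-free formula of the ring language in the $K$-sort, each $\chi_i$ is a $\overline{K}$-formula, and each $\theta_i$ is a $\Gamma$-formula.
   Context: $\mathcal{L}_{RRP}$ is three-sorted: the $K$-sort (main sort) and $\overline{K}$-sort with the ring language $\{+,-,\cdot,0,1\}$, the $\Gamma$-sort with $\{+,<,0,1\}\cup\{D_n:n>1\}\cup\{\infty\}$ ($D_n$ divisibility by $n$, $\infty$ a top element), and function symbols $v:K\to\Gamma\cup\{\infty\}$, $\mathrm{ac}:K\to\overline{K}$. A $\mathbb{Z}$-group is an ordered abelian group elementarily equivalent to $(\mathbb{Z},+,<,0,1,D_n)_{n>1}$. An angular component map satisfies $\mathrm{ac}\,0=0$, restricts to a group homomorphism $K^\times\to\overline{K}^\times$, and $\mathrm{ac}\,u=u+\mathcal{M}$ for units $u$. QE in the $K$-sort: every formula is equivalent modulo $\mathrm{Th}(S)$ to one without $K$-sort quantifiers. A formula is simple if it contains no $K$-sort quantifiers. A $\Gamma$-formula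 is a formula built from the $K$-sort language, $v$ and the $\Gamma$-sort language (no $\mathrm{ac}$ or $\overline{K}$-sort symbols) containing no $K$-sort quantifiers and no atomic formulas of the $K$-sort ring language. A $\overline{K}$-formula is a formula built from the $K$-sort language, $\mathrm{ac}$ and the $\overline{K}$-sort language (no $v$ or $\Gamma$-sort symbols) containing no $K$-sort quantifiers and no atomic formulas of the $K$-sort ring language. -}

module Defs where

open import Level using (0ℓ)
open import Data.Nat using (ℕ; zero; suc)
open import Data.Integer using (ℤ; +_) renaming (_+_ to _+ℤ_; _<_ to _<ℤ_)
open import Data.Integer.Divisibility using () renaming (_∣_ to _∣ℤ_)
open import Data.Product using (Σ; ∃; _×_; _,_)
open import Data.Sum using (_⊎_)
open import Data.Empty using (⊥)
open import Data.Unit using (⊤)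
open import Data.List using (List; []; _∷_)
open import Data.List.Relation.Unary.All using (All)
open import Relation.Nullary using (¬_)
open import Relation.Binary.PropositionalEquality using (_≡_; _≢_)
open import Algebra.Structures using (IsCommutativeRing)

_∷ₑ_ : {A : Set} → A → (ℕ → A) → ℕ → A
(a ∷ₑ ρ) zero = a
(a ∷ₑ ρ) (suc n) = ρ n

_⇔_ : Set → Set → Set
P ⇔ Q = (P → Q) × (Q → P)

-- L_RRP-structures  ⟨K, K̄, Γ∪{∞}, v, ac⟩
-- G is the carrier of the Γ-sort, i.e. Γ ∪ {∞}; ∞ is the constant ∞G.
-- DG k interprets the divisibility predicate D_{k+2}.

record LStructure : Set₁ where
  field
    K Kb G : Set
    _+K_ _*K_ : K → K → K
    -K_ : K → K
    0K 1K : K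
    _+B_ _*B_ : Kb → Kb → Kb
    -B_ : Kb → Kb
    0B 1B : Kb
    _+G_ : G → G → G
    _<G_ : G → G → Set
    0G 1G ∞G : G
    DG : ℕ → G → Set
    val : K → G
    ac : K → Kb

data KTerm : Set where
  kvar : ℕ → KTerm
  k0 k1 : KTerm
  _k+_ _k*_ : KTerm → KTerm → KTerm
  k-_ : KTerm → KTerm

data KbTerm : Set where
  bvar : ℕ → KbTerm
  b0 b1 : KbTerm
  _b+_ _b*_ : KbTerm → KbTerm → KbTerm
  b-_ : KbTerm → KbTerm
  bac : KTerm → KbTerm

data GTerm : Set where
  gvar : ℕ → GTerm
  g0 g1 g∞ : GTerm
  _g+_ : GTerm → GTerm → GTerm
  gv : KTerm → GTerm

-- Dg k t  is the atomic formula  D_{k+2}(t)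
data Formula : Set where
  _≐K_ : KTerm → KTerm → Formula
  _≐B_ : KbTerm → KbTerm → Formula
  _≐G_ : GTerm → GTerm → Formula
  _<g_ : GTerm → GTerm → Formula
  Dg : ℕ → GTerm → Formula
  ⊤f ⊥f : Formula
  ¬f_ : Formula → Formula
  _∧f_ _∨f_ : Formula → Formula → Formula
  ∃K ∀K ∃B ∀B ∃G ∀G : Formula → Formula

module Sem (M : LStructure) where
  open LStructure M

  evK : (ℕ → K) → KTerm → K
  evK ρ (kvar n) = ρ n
  evK ρ k0 = 0K
  evK ρ k1 = 1K
  evK ρ (s k+ t) = evK ρ s +K evK ρ t
  evK ρ (s k* t) = evK ρ s *K evK ρ t
  evK ρ (k- t) = -K evK ρ t

  evB : (ℕ → K) → (ℕ → Kb) → KbTerm → Kb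
  evB ρ σ (bvar n) = σ n
  evB ρ σ b0 = 0B
  evB ρ σ b1 = 1B
  evB ρ σ (s b+ t) = evB ρ σ s +B evB ρ σ t
  evB ρ σ (s b* t) = evB ρ σ s *B evB ρ σ t
  evB ρ σ (b- t) = -B evB ρ σ t
  evB ρ σ (bac t) = ac (evK ρ t)

  evG : (ℕ → K) → (ℕ → G) → GTerm → G
  evG ρ τ (gvar n) = τ n
  evG ρ τ g0 = 0G
  evG ρ τ g1 = 1G
  evG ρ τ g∞ = ∞G
  evG ρ τ (s g+ t) = evG ρ τ s +G evG ρ τ t
  evG ρ τ (gv t) = val (evK ρ t)

  Sat : (ℕ → K) → (ℕ → Kb) → (ℕ → G) → Formula → Set
  Sat ρ σ τ (s ≐K t) = evK ρ s ≡ evK ρ t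
  Sat ρ σ τ (s ≐B t) = evB ρ σ s ≡ evB ρ σ t
  Sat ρ σ τ (s ≐G t) = evG ρ τ s ≡ evG ρ τ t
  Sat ρ σ τ (s <g t) = evG ρ τ s <G evG ρ τ t
  Sat ρ σ τ (Dg k t) = DG k (evG ρ τ t)
  Sat ρ σ τ ⊤f = ⊤
  Sat ρ σ τ ⊥f = ⊥
  Sat ρ σ τ (¬f φ) = ¬ Sat ρ σ τ φ
  Sat ρ σ τ (φ ∧f ψ) = Sat ρ σ τ φ × Sat ρ σ τ ψ
  Sat ρ σ τ (φ ∨f ψ) = Sat ρ σ τ φ ⊎ Sat ρ σ τ ψ
  Sat ρ σ τ (∃K φ) = Σ K (λ a → Sat (a ∷ₑ ρ) σ τ φ)
  Sat ρ σ τ (∀K φ) = (a : K) → Sat (a ∷ₑ ρ) σ τ φ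
  Sat ρ σ τ (∃B φ) = Σ Kb (λ a → Sat ρ (a ∷ₑ σ) τ φ)
  Sat ρ σ τ (∀B φ) = (a : Kb) → Sat ρ (a ∷ₑ σ) τ φ
  Sat ρ σ τ (∃G φ) = Σ G (λ a → Sat ρ σ (a ∷ₑ τ) φ)
  Sat ρ σ τ (∀G φ) = (a : G) → Sat ρ σ (a ∷ₑ τ) φ

  Valid : Formula → Set
  Valid φ = ∀ ρ σ τ → Sat ρ σ τ φ

open Sem public

ModelOfTh : LStructure → LStructure → Set
ModelOfTh S M = ∀ φ → Valid S φ → Valid M φ

EquivModTh : LStructure → Formula → Formula → Set₁
EquivModTh S φ ψ = ∀ M → ModelOfTh S M → ∀ ρ σ τ → Sat M ρ σ τ φ ⇔ Sat M ρ σ τ ψ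

Simple : Formula → Set
Simple (_ ≐K _) = ⊤
Simple (_ ≐B _) = ⊤
Simple (_ ≐G _) = ⊤
Simple (_ <g _) = ⊤
Simple (Dg _ _) = ⊤
Simple ⊤f = ⊤
Simple ⊥f = ⊤
Simple (¬f φ) = Simple φ
Simple (φ ∧f ψ) = Simple φ × Simple ψ
Simple (φ ∨f ψ) = Simple φ × Simple ψ
Simple (∃K φ) = ⊥
Simple (∀K φ) = ⊥
Simple (∃B φ) = Simple φ
Simple (∀B φ) = Simple φ
Simple (∃G φ) = Simple φ
Simple (∀G φ) = Simple φ

QEinK : LStructure → Set₁
QEinK S = ∀ φ → Σ Formula (λ ψ → Simple ψ × EquivModTh S φ ψ)

RingQF : Formula → Set
RingQF (_ ≐K _) = ⊤
RingQF (_ ≐B _) = ⊥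
RingQF (_ ≐G _) = ⊥
RingQF (_ <g _) = ⊥
RingQF (Dg _ _) = ⊥
RingQF ⊤f = ⊤
RingQF ⊥f = ⊤
RingQF (¬f φ) = RingQF φ
RingQF (φ ∧f ψ) = RingQF φ × RingQF ψ
RingQF (φ ∨f ψ) = RingQF φ × RingQF ψ
RingQF (∃K φ) = ⊥
RingQF (∀K φ) = ⊥
RingQF (∃B φ) = ⊥
RingQF (∀B φ) = ⊥
RingQF (∃G φ) = ⊥
RingQF (∀G φ) = ⊥

-- K̄-formula: K-terms, ac and the K̄-sort language only; no K-quantifiers,
-- no K-sort ring atoms (and no v / Γ-sort symbols, hence no Γ-quantifiers)
KbarFormula : Formula → Set
KbarFormula (_ ≐K _) = ⊥
KbarFormula (_ ≐B _) = ⊤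
KbarFormula (_ ≐G _) = ⊥
KbarFormula (_ <g _) = ⊥
KbarFormula (Dg _ _) = ⊥
KbarFormula ⊤f = ⊤
KbarFormula ⊥f = ⊤
KbarFormula (¬f φ) = KbarFormula φ
KbarFormula (φ ∧f ψ) = KbarFormula φ × KbarFormula ψ
KbarFormula (φ ∨f ψ) = KbarFormula φ × KbarFormula ψ
KbarFormula (∃K φ) = ⊥
KbarFormula (∀K φ) = ⊥
KbarFormula (∃B φ) = KbarFormula φ
KbarFormula (∀B φ) = KbarFormula φ
KbarFormula (∃G φ) = ⊥
KbarFormula (∀G φ) = ⊥

-- Γ-formula: K-terms, v and the Γ-sort language only; no K-quantifiers,
-- no K-sort ring atoms (and no ac / K̄-sort symbols, hence no K̄-quantifiers)
GammaFormula : Formula → Set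
GammaFormula (_ ≐K _) = ⊥
GammaFormula (_ ≐B _) = ⊥
GammaFormula (_ ≐G _) = ⊤
GammaFormula (_ <g _) = ⊤
GammaFormula (Dg _ _) = ⊤
GammaFormula ⊤f = ⊤
GammaFormula ⊥f = ⊤
GammaFormula (¬f φ) = GammaFormula φ
GammaFormula (φ ∧f ψ) = GammaFormula φ × GammaFormula ψ
GammaFormula (φ ∨f ψ) = GammaFormula φ × GammaFormula ψ
GammaFormula (∃K φ) = ⊥
GammaFormula (∀K φ) = ⊥
GammaFormula (∃B φ) = ⊥
GammaFormula (∀B φ) = ⊥
GammaFormula (∃G φ) = GammaFormula φ
GammaFormula (∀G φ) = GammaFormula φ

BigOr : List (Formula × Formula × Formula) → Formula
BigOr [] = ⊥f
BigOr ((σ , χ , θ) ∷ l) = (σ ∧f (χ ∧f θ)) ∨f BigOr l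

Shape : Formula × Formula × Formula → Set
Shape (σ , χ , θ) = RingQF σ × KbarFormula χ × GammaFormula θ

IsFieldOn : (A : Set) → (A → A → A) → (A → A → A) → (A → A) → A → A → Set
IsFieldOn A _+_ _*_ -_ 0# 1# =
  IsCommutativeRing _≡_ _+_ _*_ -_ 0# 1# × 0# ≢ 1# ×
  (∀ x → x ≢ 0# → Σ A (λ y → x * y ≡ 1#))

natCast : {A : Set} → (A → A → A) → A → A → ℕ → A
natCast _+_ 0# 1# zero = 0#
natCast _+_ 0# 1# (suc n) = 1# + natCast _+_ 0# 1# n

CharZero : (A : Set) → (A → A → A) → A → A → Set
CharZero A _+_ 0# 1# = ∀ n → natCast _+_ 0# 1# (suc n) ≢ 0#

module Conds (S : LStructure) where
  open LStructure S

  _≤G_ : G → G → Set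
  a ≤G b = (a <G b) ⊎ (a ≡ b)

  InfinityTop : Set
  InfinityTop = (∀ g → g ≢ ∞G → g <G ∞G) × (∀ g → ¬ (∞G <G g)) ×
                (∀ g → (g +G ∞G ≡ ∞G) × (∞G +G g ≡ ∞G))

  ValuationMap : Set
  ValuationMap =
    (∀ x → (val x ≡ ∞G) ⇔ (x ≡ 0K)) ×
    (∀ x y → val (x *K y) ≡ val x +G val y) ×
    (∀ x y → (val x ≤G val (x +K y)) ⊎ (val y ≤G val (x +K y))) ×
    (∀ g → Σ K (λ x → val x ≡ g))

  InO : K → Set
  InO x = 0G ≤G val x

  InM : K → Set
  InM x = 0G <G val x

  -- res : O → K̄ is a surjective ring homomorphism with kernel M (K̄ = O/M)
  ResidueMap : (K → Kb) → Set
  ResidueMap res =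
    (∀ x y → InO x → InO y → res (x +K y) ≡ res x +B res y) ×
    (∀ x y → InO x → InO y → res (x *K y) ≡ res x *B res y) ×
    (res 1K ≡ 1B) ×
    (∀ b → Σ K (λ x → InO x × res x ≡ b)) ×
    (∀ x → InO x → (res x ≡ 0B) ⇔ InM x)

  AngularComponent : Set
  AngularComponent =
    (ac 0K ≡ 0B) ×
    (∀ x → x ≢ 0K → ac x ≢ 0B) ×
    (∀ x y → x ≢ 0K → y ≢ 0K → ac (x *K y) ≡ ac x *B ac y) ×
    Σ (K → Kb) (λ res → ResidueMap res × (∀ u → val u ≡ 0G → ac u ≡ res u))

open Conds public

-- Z-groups: language {+,<,0,1,D_n} of ordered groups, semantics relativised
-- to a subset dom of a carrier.

data ZTerm : Set where
  zvar : ℕ → ZTerm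
  z0 z1 : ZTerm
  _z+_ : ZTerm → ZTerm → ZTerm

-- ZD k t is D_{k+2}(t)
data ZFormula : Set where
  _≐Z_ _<Z_ : ZTerm → ZTerm → ZFormula
  ZD : ℕ → ZTerm → ZFormula
  ⊤z ⊥z : ZFormula
  ¬z_ : ZFormula → ZFormula
  _∧z_ _∨z_ : ZFormula → ZFormula → ZFormula
  ∃z ∀z : ZFormula → ZFormula

record OGStr : Set₁ where
  field
    A : Set
    dom : A → Set
    add : A → A → A
    lt : A → A → Set
    zero# one# : A
    D : ℕ → A → Set

module ZSem (M : OGStr) where
  open OGStr M

  evZ : (ℕ → A) → ZTerm → A
  evZ ρ (zvar n) = ρ n
  evZ ρ z0 = zero#
  evZ ρ z1 = one#
  evZ ρ (s z+ t) = add (evZ ρ s) (evZ ρ t)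

  SatZ : (ℕ → A) → ZFormula → Set
  SatZ ρ (s ≐Z t) = evZ ρ s ≡ evZ ρ t
  SatZ ρ (s <Z t) = lt (evZ ρ s) (evZ ρ t)
  SatZ ρ (ZD k t) = D k (evZ ρ t)
  SatZ ρ ⊤z = ⊤
  SatZ ρ ⊥z = ⊥
  SatZ ρ (¬z φ) = ¬ SatZ ρ φ
  SatZ ρ (φ ∧z ψ) = SatZ ρ φ × SatZ ρ ψ
  SatZ ρ (φ ∨z ψ) = SatZ ρ φ ⊎ SatZ ρ ψ
  SatZ ρ (∃z φ) = Σ A (λ a → dom a × SatZ (a ∷ₑ ρ) φ)
  SatZ ρ (∀z φ) = (a : A) → dom a → SatZ (a ∷ₑ ρ) φ

  ValidZ : ZFormula → Set
  ValidZ φ = (ρ : ℕ → A) → (∀ n → dom (ρ n)) → SatZ ρ φ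

open ZSem public

ℤstr : OGStr
ℤstr = record
  { A = ℤ ; dom = λ _ → ⊤ ; add = _+ℤ_ ; lt = _<ℤ_
  ; zero# = + 0 ; one# = + 1 ; D = λ k x → (+ suc (suc k)) ∣ℤ x }

-- Γ = (Γ ∪ {∞}) ∖ {∞} with the structure induced from S
Γstr : LStructure → OGStr
Γstr S = record
  { A = G ; dom = λ g → g ≢ ∞G ; add = _+G_ ; lt = _<G_
  ; zero# = 0G ; one# = 1G ; D = DG }
  where open LStructure S

-- Γ is a Z-group: Γ ≡ (ℤ,+,<,0,1,D_n)_{n>1}
IsZGroup : LStructure → Set
IsZGroup S = ∀ φ → ValidZ (Γstr S) φ ⇔ ValidZ ℤstr φ

module Submission where

-- A *cell* is a triple (σ , χ , θ) with σ a quantifier-free ring formula,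
-- χ a K̄-formula and θ a Γ-formula, read as σ ∧ χ ∧ θ.  We show that every
-- simple formula is equivalent, in every L_RRP-structure, to a finite
-- disjunction of cells, by recursion on the formula:
--   * atoms and ⊤ are single cells, ⊥ is the empty disjunction;
--   * ∨ is concatenation and ∧ the distributive product of cell lists;
--   * ¬ of a disjunction is, by De Morgan, the conjunction over its cells of
--     ¬σ ∨ ¬χ ∨ ¬θ (this is where excluded middle is used);
--   * ∃ over K̄ (resp. Γ) moves into the χ- (resp. θ-) component of each
--     cell, because the other two components do not mention that sort;
--   * ∀ = ¬∃¬.
-- The normal form holds in every structure.

open import Defs
open import Level using (0ℓ)
open import Axiom.ExcludedMiddle using (ExcludedMiddle)
open import Axiom.DoubleNegationElimination using (em⇒dne)
open import Data.Product using (Σ; _×_; _,_; proj₁; proj₂; swap)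
open import Data.Sum using (inj₁; inj₂; [_,_]′)
open import Data.Unit using (tt)
open import Data.Empty using (⊥-elim)
open import Data.Nat using (ℕ)
open import Data.List using (List; []; _∷_; [_]; _++_; map; foldr; cartesianProductWith)
open import Data.List.Relation.Unary.All using (All; []; _∷_; fromList)
open import Data.List.Relation.Unary.All.Properties using (¬Any⇒All¬; All¬⇒¬Any)
open import Data.List.Relation.Unary.Any as Any using (Any; here; there)
import Data.List.Relation.Unary.Any.Properties as Anyₚ
open import Relation.Nullary using (¬_; yes; no)
open LStructure using (K; Kb; _+K_; _*K_; -K_; 0K; 1K; _+B_; _*B_; -B_; 0B; 1B)

⇔-trans : {P Q R : Set} → P ⇔ Q → Q ⇔ R → P ⇔ R
⇔-trans (f , g) (h , k) = (λ x → h (f x)) , (λ z → g (k z))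

×-⇔ : {P P′ Q Q′ : Set} → P ⇔ P′ → Q ⇔ Q′ → (P × Q) ⇔ (P′ × Q′)
×-⇔ (f , g) (h , k) = (λ { (p , q) → f p , h q }) , (λ { (p , q) → g p , k q })

Σ-⇔ : {A : Set} {P Q : A → Set} → (∀ a → P a ⇔ Q a) → Σ A P ⇔ Σ A Q
Σ-⇔ e = (λ { (a , h) → a , proj₁ (e a) h }) , (λ { (a , h) → a , proj₂ (e a) h })

∀⇔¬∃¬ : ExcludedMiddle 0ℓ → {A : Set} {P : A → Set} → ((a : A) → P a) ⇔ (¬ Σ A (λ a → ¬ P a))
∀⇔¬∃¬ em = (λ h (a , n) → n (h a)) , (λ n a → em⇒dne em (λ na → n (a , na)))

Cell : Set
Cell = Σ (Formula × Formula × Formula) Shape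

cellFormula : Cell → Formula
cellFormula ((σ , χ , θ) , _) = σ ∧f (χ ∧f θ)

ringCell : (σ : Formula) → RingQF σ → Cell
ringCell σ p = (σ , ⊤f , ⊤f) , p , tt , tt

kbarCell : (χ : Formula) → KbarFormula χ → Cell
kbarCell χ p = (⊤f , χ , ⊤f) , tt , p , tt

gammaCell : (θ : Formula) → GammaFormula θ → Cell
gammaCell θ p = (⊤f , ⊤f , θ) , tt , tt , p

⊤cell : Cell
⊤cell = ringCell ⊤f tt

conjCell : Cell → Cell → Cell
conjCell ((σ , χ , θ) , p , q , r) ((σ′ , χ′ , θ′) , p′ , q′ , r′) =
  (σ ∧f σ′ , χ ∧f χ′ , θ ∧f θ′) , (p , p′) , (q , q′) , (r , r′)

negCell : Cell → List Cell
negCell ((σ , χ , θ) , p , q , r) =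
  ringCell (¬f σ) p ∷ kbarCell (¬f χ) q ∷ gammaCell (¬f θ) r ∷ []

∃BCell : Cell → Cell
∃BCell ((σ , χ , θ) , s) = (σ , ∃B χ , θ) , s

∃GCell : Cell → Cell
∃GCell ((σ , χ , θ) , s) = (σ , χ , ∃G θ) , s

_∧ᶜ_ : List Cell → List Cell → List Cell
_∧ᶜ_ = cartesianProductWith conjCell

¬ᶜ_ : List Cell → List Cell
¬ᶜ_ = foldr (λ c cs → negCell c ∧ᶜ cs) [ ⊤cell ]

normalForm : (φ : Formula) → Simple φ → List Cell
normalForm (s ≐K t) _ = [ ringCell (s ≐K t) tt ]
normalForm (s ≐B t) _ = [ kbarCell (s ≐B t) tt ]
normalForm (s ≐G t) _ = [ gammaCell (s ≐G t) tt ]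
normalForm (s <g t) _ = [ gammaCell (s <g t) tt ]
normalForm (Dg k t) _ = [ gammaCell (Dg k t) tt ]
normalForm ⊤f _ = [ ⊤cell ]
normalForm ⊥f _ = []
normalForm (¬f φ) p = ¬ᶜ normalForm φ p
normalForm (φ ∧f ψ) (p , q) = normalForm φ p ∧ᶜ normalForm ψ q
normalForm (φ ∨f ψ) (p , q) = normalForm φ p ++ normalForm ψ q
normalForm (∃B φ) p = map ∃BCell (normalForm φ p)
normalForm (∀B φ) p = ¬ᶜ map ∃BCell (¬ᶜ normalForm φ p)
normalForm (∃G φ) p = map ∃GCell (normalForm φ p)
normalForm (∀G φ) p = ¬ᶜ map ∃GCell (¬ᶜ normalForm φ p)

module Semantics (M : LStructure) where
  open LStructure M using () renaming (K to KM; Kb to KbM; G to GM)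

  -- Locality: each kind of component only reads the environments of the
  -- sorts it mentions, so it is unaffected by a quantifier over another sort.

  ringQF-local : ∀ {ρ σ σ′ τ τ′} θ → RingQF θ → Sat M ρ σ τ θ → Sat M ρ σ′ τ′ θ
  ringQF-local (s ≐K t) _ h = h
  ringQF-local ⊤f _ h = h
  ringQF-local (¬f θ) r h = λ h′ → h (ringQF-local θ r h′)
  ringQF-local (θ ∧f θ′) (r , r′) (h , h′) = ringQF-local θ r h , ringQF-local θ′ r′ h′
  ringQF-local (θ ∨f θ′) (r , r′) (inj₁ h) = inj₁ (ringQF-local θ r h)
  ringQF-local (θ ∨f θ′) (r , r′) (inj₂ h) = inj₂ (ringQF-local θ′ r′ h)

  kbar-local : ∀ {ρ σ τ τ′} θ → KbarFormula θ → Sat M ρ σ τ θ → Sat M ρ σ τ′ θ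
  kbar-local (s ≐B t) _ h = h
  kbar-local ⊤f _ h = h
  kbar-local (¬f θ) r h = λ h′ → h (kbar-local θ r h′)
  kbar-local (θ ∧f θ′) (r , r′) (h , h′) = kbar-local θ r h , kbar-local θ′ r′ h′
  kbar-local (θ ∨f θ′) (r , r′) (inj₁ h) = inj₁ (kbar-local θ r h)
  kbar-local (θ ∨f θ′) (r , r′) (inj₂ h) = inj₂ (kbar-local θ′ r′ h)
  kbar-local (∃B θ) r (a , h) = a , kbar-local θ r h
  kbar-local (∀B θ) r h = λ a → kbar-local θ r (h a)

  gamma-local : ∀ {ρ σ σ′ τ} θ → GammaFormula θ → Sat M ρ σ τ θ → Sat M ρ σ′ τ θ
  gamma-local (s ≐G t) _ h = h
  gamma-local (s <g t) _ h = h
  gamma-local (Dg k t) _ h = h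
  gamma-local ⊤f _ h = h
  gamma-local (¬f θ) r h = λ h′ → h (gamma-local θ r h′)
  gamma-local (θ ∧f θ′) (r , r′) (h , h′) = gamma-local θ r h , gamma-local θ′ r′ h′
  gamma-local (θ ∨f θ′) (r , r′) (inj₁ h) = inj₁ (gamma-local θ r h)
  gamma-local (θ ∨f θ′) (r , r′) (inj₂ h) = inj₂ (gamma-local θ′ r′ h)
  gamma-local (∃G θ) r (a , h) = a , gamma-local θ r h
  gamma-local (∀G θ) r h = λ a → gamma-local θ r (h a)

  Holds : (ℕ → KM) → (ℕ → KbM) → (ℕ → GM) → Cell → Set
  Holds ρ σ τ c = Sat M ρ σ τ (cellFormula c)

  record Represents (φ : Formula) (cs : List Cell) : Set where
    constructor represents
    field equiv : ∀ ρ σ τ → Sat M ρ σ τ φ ⇔ Any (Holds ρ σ τ) cs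
  open Represents public

  bigOr⇔Any : ∀ ρ σ τ cs → Sat M ρ σ τ (BigOr (map proj₁ cs)) ⇔ Any (Holds ρ σ τ) cs
  bigOr⇔Any ρ σ τ [] = (λ ()) , (λ ())
  bigOr⇔Any ρ σ τ (((_ , _ , _) , _) ∷ cs) =
    [ here , (λ h → there (proj₁ (bigOr⇔Any ρ σ τ cs) h)) ]′ ,
    λ { (here h) → inj₁ h ; (there h) → inj₂ (proj₂ (bigOr⇔Any ρ σ τ cs) h) }

  module _ (ρ : ℕ → KM) (σ : ℕ → KbM) (τ : ℕ → GM) where

    conjCell-holds : ∀ c d → Holds ρ σ τ (conjCell c d) ⇔ (Holds ρ σ τ c × Holds ρ σ τ d)
    conjCell-holds ((_ , _ , _) , _) ((_ , _ , _) , _) =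
      (λ { ((a , a′) , (b , b′) , (d , d′)) → (a , b , d) , (a′ , b′ , d′) }) ,
      (λ { ((a , b , d) , (a′ , b′ , d′)) → (a , a′) , (b , b′) , (d , d′) })

    any-∧ᶜ : ∀ cs ds → Any (Holds ρ σ τ) (cs ∧ᶜ ds) ⇔ (Any (Holds ρ σ τ) cs × Any (Holds ρ σ τ) ds)
    any-∧ᶜ cs ds =
      Anyₚ.cartesianProductWith⁻ conjCell (λ {c} {d} → proj₁ (conjCell-holds c d)) cs ds ,
      λ { (hc , hd) → Anyₚ.cartesianProductWith⁺ conjCell
                        (λ {c} {d} hc hd → proj₂ (conjCell-holds c d) (hc , hd)) hc hd }

    negCell-refutes : ∀ c → Any (Holds ρ σ τ) (negCell c) → ¬ Holds ρ σ τ c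
    negCell-refutes ((_ , _ , _) , _) (here (ns , _)) (hs , _) = ns hs
    negCell-refutes ((_ , _ , _) , _) (there (here (_ , nχ , _))) (_ , hχ , _) = nχ hχ
    negCell-refutes ((_ , _ , _) , _) (there (there (here (_ , _ , nθ)))) (_ , _ , hθ) = nθ hθ

    negCell-covers : ExcludedMiddle 0ℓ → ∀ c → ¬ Holds ρ σ τ c → Any (Holds ρ σ τ) (negCell c)
    negCell-covers em ((s , χ , θ) , _) n
      with em {Sat M ρ σ τ s} | em {Sat M ρ σ τ χ} | em {Sat M ρ σ τ θ}
    ... | no ns | _ | _ = here (ns , tt , tt)
    ... | yes _ | no nχ | _ = there (here (tt , nχ , tt))
    ... | yes _ | yes _ | no nθ = there (there (here (tt , tt , nθ)))
    ... | yes hs | yes hχ | yes hθ = ⊥-elim (n (hs , hχ , hθ))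

    any-¬ᶜ : ExcludedMiddle 0ℓ → ∀ cs → Any (Holds ρ σ τ) (¬ᶜ cs) ⇔ All (λ c → ¬ Holds ρ σ τ c) cs
    any-¬ᶜ em [] = (λ _ → []) , (λ _ → here (tt , tt , tt))
    any-¬ᶜ em (c ∷ cs) =
      ⇔-trans (any-∧ᶜ (negCell c) (¬ᶜ cs))
        (⇔-trans (×-⇔ (negCell-refutes c , negCell-covers em c) (any-¬ᶜ em cs))
          ((λ { (n , ns) → n ∷ ns }) , (λ { (n ∷ ns) → n , ns })))

    any-¬ᶜ⇔¬any : ExcludedMiddle 0ℓ → ∀ cs → Any (Holds ρ σ τ) (¬ᶜ cs) ⇔ (¬ Any (Holds ρ σ τ) cs)
    any-¬ᶜ⇔¬any em cs =
      ⇔-trans (any-¬ᶜ em cs) (All¬⇒¬Any , ¬Any⇒All¬ cs)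

    ∃BCell-holds : ∀ c → Holds ρ σ τ (∃BCell c) ⇔ Σ KbM (λ a → Holds ρ (a ∷ₑ σ) τ c)
    ∃BCell-holds ((s , χ , θ) , p , _ , r) =
      (λ { (hs , (a , hχ) , hθ) → a , ringQF-local s p hs , hχ , gamma-local θ r hθ }) ,
      (λ { (a , hs , hχ , hθ) → ringQF-local s p hs , (a , hχ) , gamma-local θ r hθ })

    ∃GCell-holds : ∀ c → Holds ρ σ τ (∃GCell c) ⇔ Σ GM (λ a → Holds ρ σ (a ∷ₑ τ) c)
    ∃GCell-holds ((s , χ , θ) , p , q , _) =
      (λ { (hs , hχ , (a , hθ)) → a , ringQF-local s p hs , kbar-local χ q hχ , hθ }) ,
      (λ { (a , hs , hχ , hθ) → ringQF-local s p hs , kbar-local χ q hχ , (a , hθ) })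

    any-∃BCell : ∀ cs → Any (Holds ρ σ τ) (map ∃BCell cs) ⇔ Σ KbM (λ a → Any (Holds ρ (a ∷ₑ σ) τ) cs)
    any-∃BCell cs =
      (λ h → Anyₚ.Any-Σ⁻ʳ {_~_ = R} (Any.map (λ {c} → proj₁ (∃BCell-holds c)) (Anyₚ.map⁻ h))) ,
      (λ h → Anyₚ.map⁺ (Any.map (λ {c} → proj₂ (∃BCell-holds c)) (Anyₚ.Any-Σ⁺ʳ {_~_ = R} h)))
      where
      R : Cell → KbM → Set
      R c a = Holds ρ (a ∷ₑ σ) τ c

    any-∃GCell : ∀ cs → Any (Holds ρ σ τ) (map ∃GCell cs) ⇔ Σ GM (λ a → Any (Holds ρ σ (a ∷ₑ τ)) cs)
    any-∃GCell cs =
      (λ h → Anyₚ.Any-Σ⁻ʳ {_~_ = R} (Any.map (λ {c} → proj₁ (∃GCell-holds c)) (Anyₚ.map⁻ h))) ,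
      (λ h → Anyₚ.map⁺ (Any.map (λ {c} → proj₂ (∃GCell-holds c)) (Anyₚ.Any-Σ⁺ʳ {_~_ = R} h)))
      where
      R : Cell → GM → Set
      R c a = Holds ρ σ (a ∷ₑ τ) c

  represents-ringCell : ∀ σ p → Represents σ [ ringCell σ p ]
  represents-ringCell _ _ = represents λ ρ σ τ →
    (λ h → here (h , tt , tt)) , (λ h → proj₁ (Anyₚ.singleton⁻ h))

  represents-kbarCell : ∀ χ p → Represents χ [ kbarCell χ p ]
  represents-kbarCell _ _ = represents λ ρ σ τ →
    (λ h → here (tt , h , tt)) , (λ h → proj₁ (proj₂ (Anyₚ.singleton⁻ h)))

  represents-gammaCell : ∀ θ p → Represents θ [ gammaCell θ p ]
  represents-gammaCell _ _ = represents λ ρ σ τ →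
    (λ h → here (tt , tt , h)) , (λ h → proj₂ (proj₂ (Anyₚ.singleton⁻ h)))

  represents-∨ : ∀ {φ ψ cs ds} → Represents φ cs → Represents ψ ds → Represents (φ ∨f ψ) (cs ++ ds)
  represents-∨ {cs = cs} rφ rψ = represents λ ρ σ τ →
    [ (λ h → Anyₚ.++⁺ˡ (proj₁ (equiv rφ ρ σ τ) h)) , (λ h → Anyₚ.++⁺ʳ cs (proj₁ (equiv rψ ρ σ τ) h)) ]′ ,
    (λ h → [ (λ h′ → inj₁ (proj₂ (equiv rφ ρ σ τ) h′)) , (λ h′ → inj₂ (proj₂ (equiv rψ ρ σ τ) h′)) ]′
             (Anyₚ.++⁻ cs h))

  represents-∧ : ∀ {φ ψ cs ds} → Represents φ cs → Represents ψ ds → Represents (φ ∧f ψ) (cs ∧ᶜ ds)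
  represents-∧ {cs = cs} {ds} rφ rψ = represents λ ρ σ τ →
    ⇔-trans (×-⇔ (equiv rφ ρ σ τ) (equiv rψ ρ σ τ)) (swap (any-∧ᶜ ρ σ τ cs ds))

  represents-¬ : ExcludedMiddle 0ℓ → ∀ {φ cs} → Represents φ cs → Represents (¬f φ) (¬ᶜ cs)
  represents-¬ em {cs = cs} rφ = represents λ ρ σ τ →
    (λ n → proj₂ (any-¬ᶜ⇔¬any ρ σ τ em cs) (λ h → n (proj₂ (equiv rφ ρ σ τ) h))) ,
    (λ h hφ → proj₁ (any-¬ᶜ⇔¬any ρ σ τ em cs) h (proj₁ (equiv rφ ρ σ τ) hφ))

  represents-∃B : ∀ {φ cs} → Represents φ cs → Represents (∃B φ) (map ∃BCell cs)
  represents-∃B {cs = cs} rφ = represents λ ρ σ τ →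
    ⇔-trans (Σ-⇔ λ a → equiv rφ ρ (a ∷ₑ σ) τ) (swap (any-∃BCell ρ σ τ cs))

  represents-∃G : ∀ {φ cs} → Represents φ cs → Represents (∃G φ) (map ∃GCell cs)
  represents-∃G {cs = cs} rφ = represents λ ρ σ τ →
    ⇔-trans (Σ-⇔ λ a → equiv rφ ρ σ (a ∷ₑ τ)) (swap (any-∃GCell ρ σ τ cs))

  represents-resp : ∀ {φ ψ cs} → (∀ ρ σ τ → Sat M ρ σ τ φ ⇔ Sat M ρ σ τ ψ) →
                    Represents ψ cs → Represents φ cs
  represents-resp e rψ = represents λ ρ σ τ → ⇔-trans (e ρ σ τ) (equiv rψ ρ σ τ)

  normalForm-represents : ExcludedMiddle 0ℓ → ∀ φ p → Represents φ (normalForm φ p)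
  normalForm-represents em (s ≐K t) _ = represents-ringCell (s ≐K t) tt
  normalForm-represents em (s ≐B t) _ = represents-kbarCell (s ≐B t) tt
  normalForm-represents em (s ≐G t) _ = represents-gammaCell (s ≐G t) tt
  normalForm-represents em (s <g t) _ = represents-gammaCell (s <g t) tt
  normalForm-represents em (Dg k t) _ = represents-gammaCell (Dg k t) tt
  normalForm-represents em ⊤f _ = represents-ringCell ⊤f tt
  normalForm-represents em ⊥f _ = represents λ _ _ _ → (λ ()) , (λ ())
  normalForm-represents em (¬f φ) p = represents-¬ em (normalForm-represents em φ p)
  normalForm-represents em (φ ∧f ψ) (p , q) =
    represents-∧ (normalForm-represents em φ p) (normalForm-represents em ψ q)
  normalForm-represents em (φ ∨f ψ) (p , q) =
    represents-∨ (normalForm-represents em φ p) (normalForm-represents em ψ q)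
  normalForm-represents em (∃B φ) p = represents-∃B (normalForm-represents em φ p)
  normalForm-represents em (∀B φ) p = represents-resp (λ _ _ _ → ∀⇔¬∃¬ em)
    (represents-¬ em (represents-∃B (represents-¬ em (normalForm-represents em φ p))))
  normalForm-represents em (∃G φ) p = represents-∃G (normalForm-represents em φ p)
  normalForm-represents em (∀G φ) p = represents-resp (λ _ _ _ → ∀⇔¬∃¬ em)
    (represents-¬ em (represents-∃G (represents-¬ em (normalForm-represents em φ p))))

lemma5p3 : ExcludedMiddle 0ℓ →
    (S : LStructure) →
    IsFieldOn (K S) (_+K_ S) (_*K_ S) (-K_ S) (0K S) (1K S) →
    IsFieldOn (Kb S) (_+B_ S) (_*B_ S) (-B_ S) (0B S) (1B S) →
    CharZero (K S) (_+K_ S) (0K S) (1K S) →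
    CharZero (Kb S) (_+B_ S) (0B S) (1B S) →
    InfinityTop S →
    ValuationMap S →
    AngularComponent S →
    IsZGroup S →
    QEinK S →
    (φ : Formula) → Simple φ →
    Σ (List (Formula × Formula × Formula))
    (λ l → All Shape l × EquivModTh S φ (BigOr l))
lemma5p3 em S _ _ _ _ _ _ _ _ _ φ p =
  map proj₁ cells , fromList cells , equivalent
  where
  cells : List Cell
  cells = normalForm φ p

  equivalent : EquivModTh S φ (BigOr (map proj₁ cells))
  equivalent M _ ρ σ τ =
    ⇔-trans (equiv (normalForm-represents em φ p) ρ σ τ) (swap (bigOr⇔Any ρ σ τ cells))
    where open Semantics M
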